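{- Let $D'$ be a database, $Q\in\{\forall,\exists\}$, and $\mathit{var}\in\{\mathit{obl},\mathit{rest},\mathit{core}\}$. There is a many-one reduction from $\mathsf{CT}^{\mathit{var}}_{Q}$ (the class of knowledge bases) to $\mathsf{CT}^{\mathit{var}}_{D'Q}$ (the class of rule sets $\Sigma$ with $\langle\Sigma,D'\rangle\in\mathsf{CT}^{\mathit{var}}_{Q}$), and a many-one reduction in the other direction.
   Context: Existential rules are closed formulas $\forall \vec x,\vec y.\, B[\vec x,\vec y]\to\exists \vec z.\, H[\vec y,\vec z]$ with null-free atom conjunctions $B$ and non-empty $H$ (rules with empty body are allowed). A database is a finite set of null-free facts; a knowledge base (KB) is a pair $\langle\Sigma,D\rangle$ of a finite rule set and a database. Triggers $\langle R,\sigma\rangle$ ($\sigma$ defined exactly on the universally quantified variables of $R\in\Sigma$) are loaded for a fact set $F$ if $\sigma(\mathrm{body}(R))\subseteq F$, obsolete if some extension $\sigma'$ of $\sigma$ to existential variables maps $\mathrm{head}(R)$ into $F$; the output is $\sigma'(\mathrm{head}(R))$ with existential variables mapped to fresh nulls. The chase variants: the restricted chase ($\mathit{rest}$) builds sequences $F_0=D$, $F_{i+1}=F_i\cup\mathrm{output}(\lambda)$ with $\lambda$ loaded and not obsolete for $F_i$, subject to fairness (every trigger loaded for some $F_i$ is obsolete for some $F_j$, $j\ge i$); the oblivious chase ($\mathit{obl}$) is analogous but applies each loaded trigger (regardless of obsolescence) exactly once, fairly; the core chase ($\mathit{core}$) applies all loaded non-obsolete triggers in parallel at each step and then replaces the result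 by its core. For a variant $\mathit{var}$, $\mathsf{CT}^{\mathit{var}}_{\exists}$ (resp. $\mathsf{CT}^{\mathit{var}}_{\forall}$) is the class of KBs admitting some finite (resp. only finite) $\mathit{var}$-chase sequences, and for a database $D'$, $\mathsf{CT}^{\mathit{var}}_{D'Q}$ is the class of rule sets $\Sigma$ with $\langle\Sigma,D'\rangle\in\mathsf{CT}^{\mathit{var}}_{Q}$. -}

module Defs where

open import Data.Nat using (ℕ; _<_; _≤_; _≟_)
open import Data.Bool using (if_then_else_)
open import Data.List using (List; []; _∷_; _++_; map; concatMap)
open import Data.List.Relation.Unary.All using (All)
open import Data.List.Membership.Propositional using (_∈_; _∉_)
open import Data.List.Relation.Binary.Subset.Propositional using (_⊆_)
open import Data.Vec as Vec using (Vec; toList)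
open import Data.Product using (Σ; ∃; ∃-syntax; _×_; _,_; proj₁; proj₂)
open import Data.Sum using (_⊎_)
open import Relation.Nullary using (¬_; Dec; yes; no; ⌊_⌋)
open import Relation.Binary.PropositionalEquality using (_≡_; _≢_; refl; cong)
open import Relation.Binary.Definitions using (DecidableEquality)
open import Function using (_⇔_)

data Term : Set where
  cst : ℕ → Term
  nul : ℕ → Term
  var : ℕ → Term

_≟T_ : DecidableEquality Term
cst a ≟T cst b with a ≟ b
... | yes refl = yes refl
... | no p = no λ { refl → p refl }
nul a ≟T nul b with a ≟ b
... | yes refl = yes refl
... | no p = no λ { refl → p refl }
var a ≟T var b with a ≟ b
... | yes refl = yes refl
... | no p = no λ { refl → p refl }
cst _ ≟T nul _ = no λ ()
cst _ ≟T var _ = no λ ()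
nul _ ≟T cst _ = no λ ()
nul _ ≟T var _ = no λ ()
var _ ≟T cst _ = no λ ()
var _ ≟T nul _ = no λ ()

open import Data.List.Membership.DecPropositional _≟T_ using (_∈?_)

-- A predicate symbol is a name together with its arity.
record Atom : Set where
  constructor atom
  field
    sym   : ℕ
    arity : ℕ
    args  : Vec Term arity
open Atom public

termsA : Atom → List Term
termsA a = toList (args a)

termsL : List Atom → List Term
termsL = concatMap termsA

NullFreeT : Term → Set
NullFreeT t = ∀ n → t ≢ nul n

IsConst : Term → Set
IsConst t = ∃[ c ] t ≡ cst c

DBFact : Atom → Set
DBFact a = All IsConst (termsA a)

-- Rules  ∀x,y. B[x,y] → ∃z. H[y,z]
-- universally quantified variables = variables of the body,
-- existential variables = variables of the head not occurring in the body.

record Rule : Set where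
  constructor rule
  field
    body : List Atom
    head : List Atom
open Rule public

WFRule : Rule → Set
WFRule R = All NullFreeT (termsL (body R)) × All NullFreeT (termsL (head R))
         × head R ≢ []

RuleSet : Set
RuleSet = Σ (List Rule) (All WFRule)

Database : Set
Database = Σ (List Atom) (All DBFact)

KB : Set
KB = RuleSet × Database

FactSet : Set
FactSet = List Atom

_≈F_ : FactSet → FactSet → Set
F ≈F G = F ⊆ G × G ⊆ F

UVar : Rule → ℕ → Set
UVar R v = var v ∈ termsL (body R)

EVar : Rule → ℕ → Set
EVar R v = var v ∈ termsL (head R) × ¬ UVar R v

Sub : Set
Sub = ℕ → Term

applyT : Sub → Term → Term
applyT σ (var v) = σ v
applyT σ t       = t

applyA : Sub → Atom → Atom
applyA σ (atom p n as) = atom p n (Vec.map (applyT σ) as)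

applyL : Sub → List Atom → List Atom
applyL σ = map (applyA σ)

record Trigger : Set where
  constructor trig
  field
    trule : Rule
    tsub  : Sub      -- only its values on UVar (trule) are relevant
open Trigger public

-- triggers are equal iff same rule and substitutions agree on the
-- universally quantified variables (σ is defined exactly there)
TrigEq : Trigger → Trigger → Set
TrigEq t t' = trule t ≡ trule t' × (∀ v → UVar (trule t) v → tsub t v ≡ tsub t' v)

TrigOf : RuleSet → Trigger → Set
TrigOf Σr t = trule t ∈ proj₁ Σr

Loaded : Trigger → FactSet → Set
Loaded t F = applyL (tsub t) (body (trule t)) ⊆ F

Obsolete : Trigger → FactSet → Set
Obsolete t F = Σ Sub λ σ' → (∀ v → UVar (trule t) v → σ' v ≡ tsub t v)
                          × applyL σ' (head (trule t)) ⊆ F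

extend : Rule → Sub → (ℕ → ℕ) → Sub
extend R σ ν v = if ⌊ var v ∈? termsL (body R) ⌋ then σ v else nul (ν v)

output : Trigger → (ℕ → ℕ) → FactSet
output t ν = applyL (extend (trule t) (tsub t) ν) (head (trule t))

Fresh : FactSet → Trigger → (ℕ → ℕ) → Set
Fresh F t ν =
  (∀ u w → EVar (trule t) u → EVar (trule t) w → ν u ≡ ν w → u ≡ w)
  × (∀ u → EVar (trule t) u → nul (ν u) ∉ termsL F)

Active : RuleSet → FactSet → Trigger → Set
Active Σr F t = TrigOf Σr t × Loaded t F × ¬ Obsolete t F

RStep : RuleSet → FactSet → Trigger → (ℕ → ℕ) → FactSet → Set
RStep Σr F t ν F' = Active Σr F t × Fresh F t ν × F' ≈F (F ++ output t ν)

FiniteRest : KB → Set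
FiniteRest (Σr , D) =
  Σ ℕ λ n → Σ (ℕ → FactSet) λ F → Σ (ℕ → Trigger) λ T → Σ (ℕ → ℕ → ℕ) λ N →
    F 0 ≈F proj₁ D
  × (∀ i → i < n → RStep Σr (F i) (T i) (N i) (F (Data.Nat.suc i)))
  × (∀ t → TrigOf Σr t → ∀ i → i ≤ n → Loaded t (F i) →
       ∃[ j ] (i ≤ j × j ≤ n × Obsolete t (F j)))

InfiniteRest : KB → Set
InfiniteRest (Σr , D) =
  Σ (ℕ → FactSet) λ F → Σ (ℕ → Trigger) λ T → Σ (ℕ → ℕ → ℕ) λ N →
    F 0 ≈F proj₁ D
  × (∀ i → RStep Σr (F i) (T i) (N i) (F (Data.Nat.suc i)))
  × (∀ t → TrigOf Σr t → ∀ i → Loaded t (F i) →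
       ∃[ j ] (i ≤ j × Obsolete t (F j)))

OStep : RuleSet → FactSet → Trigger → (ℕ → ℕ) → FactSet → Set
OStep Σr F t ν F' = TrigOf Σr t × Loaded t F × Fresh F t ν × F' ≈F (F ++ output t ν)

FiniteObl : KB → Set
FiniteObl (Σr , D) =
  Σ ℕ λ n → Σ (ℕ → FactSet) λ F → Σ (ℕ → Trigger) λ T → Σ (ℕ → ℕ → ℕ) λ N →
    F 0 ≈F proj₁ D
  × (∀ i → i < n → OStep Σr (F i) (T i) (N i) (F (Data.Nat.suc i)))
  × (∀ i j → i < n → j < n → i ≢ j → ¬ TrigEq (T i) (T j))
  × (∀ t → TrigOf Σr t → ∀ i → i ≤ n → Loaded t (F i) →
       ∃[ j ] (j < n × TrigEq t (T j)))

InfiniteObl : KB → Set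
InfiniteObl (Σr , D) =
  Σ (ℕ → FactSet) λ F → Σ (ℕ → Trigger) λ T → Σ (ℕ → ℕ → ℕ) λ N →
    F 0 ≈F proj₁ D
  × (∀ i → OStep Σr (F i) (T i) (N i) (F (Data.Nat.suc i)))
  × (∀ i j → i ≢ j → ¬ TrigEq (T i) (T j))
  × (∀ t → TrigOf Σr t → ∀ i → Loaded t (F i) →
       ∃[ j ] TrigEq t (T j))

applyH : (ℕ → Term) → Term → Term
applyH h (nul n) = h n
applyH h t       = t

applyHL : (ℕ → Term) → List Atom → List Atom
applyHL h = map λ { (atom p n as) → atom p n (Vec.map (applyH h) as) }

Hom : (ℕ → Term) → FactSet → FactSet → Set
Hom h A B = applyHL h A ⊆ B

IsCore : FactSet → Set
IsCore C = ∀ h → Hom h C C → C ⊆ applyHL h C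

CoreOf : FactSet → FactSet → Set
CoreOf G C = C ⊆ G × (Σ (ℕ → Term) λ h → Hom h G C) × IsCore C

ParStep : RuleSet → FactSet → FactSet → Set
ParStep Σr F G = Σ (Trigger → ℕ → ℕ) λ N →
    (∀ t t' → TrigEq t t' → ∀ v → N t v ≡ N t' v)
  × (∀ t → Active Σr F t → Fresh F t (N t))
  × (∀ t t' → Active Σr F t → Active Σr F t' → ¬ TrigEq t t' →
       ∀ u w → EVar (trule t) u → EVar (trule t') w → N t u ≢ N t' w)
  × (∀ a → (a ∈ G → (a ∈ F ⊎ ∃[ t ] (Active Σr F t × a ∈ output t (N t))))
         × ((a ∈ F ⊎ ∃[ t ] (Active Σr F t × a ∈ output t (N t))) → a ∈ G))

CoreStep : RuleSet → FactSet → FactSet → Set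
CoreStep Σr F F' = Σ FactSet λ G → ParStep Σr F G × CoreOf G F'

FiniteCore : KB → Set
FiniteCore (Σr , D) =
  Σ ℕ λ n → Σ (ℕ → FactSet) λ F →
    F 0 ≈F proj₁ D
  × (∀ i → i < n → (∃[ t ] Active Σr (F i) t) × CoreStep Σr (F i) (F (Data.Nat.suc i)))
  × (∀ t → ¬ Active Σr (F n) t)

InfiniteCore : KB → Set
InfiniteCore (Σr , D) =
  Σ (ℕ → FactSet) λ F →
    F 0 ≈F proj₁ D
  × (∀ i → (∃[ t ] Active Σr (F i) t) × CoreStep Σr (F i) (F (Data.Nat.suc i)))

data Variant : Set where
  obl rest core : Variant

data Quant : Set where
  ∀Q ∃Q : Quant

FiniteSeq : Variant → KB → Set
FiniteSeq obl  = FiniteObl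
FiniteSeq rest = FiniteRest
FiniteSeq core = FiniteCore

InfiniteSeq : Variant → KB → Set
InfiniteSeq obl  = InfiniteObl
InfiniteSeq rest = InfiniteRest
InfiniteSeq core = InfiniteCore

CT : Variant → Quant → KB → Set
CT v ∃Q K = FiniteSeq v K
CT v ∀Q K = ¬ InfiniteSeq v K

CTD : Database → Variant → Quant → RuleSet → Set
CTD D' v Q Σr = CT v Q (Σr , D')

-- many-one reduction: a (total, hence computable) Agda function f with
-- a ∈ P ⇔ f a ∈ Q
ManyOne : {A B : Set} → (A → Set) → (B → Set) → Set
ManyOne {A} {B} P Q = Σ (A → B) λ f → ∀ a → P a ⇔ Q (f a)

-- For a knowledge base ⟨Σ, D⟩ let Σ' consist of the body-less rule → Start ∧ ⇑D and, for each
-- rule B → H of Σ, the rule Start ∧ ⇑B → ⇑H, where ⇑ moves predicate symbols above those of D'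
-- and of the fresh nullary atom Start. A chase of Σ' from D' must begin with the body-less rule,
-- as every other rule needs Start; afterwards its fact sets are D' ∪ {Start} ∪ ⇑F for the fact
-- sets F of a chase of ⟨Σ, D⟩, and triggers, obsolescence, fresh nulls and cores correspond
-- under ⇑. So for every variant the chase sequences of the two inputs translate into each other,
-- finite into finite, and ⟨Σ, D⟩ ↦ Σ' is a reduction; in the other direction Σ ↦ ⟨Σ, D'⟩ is one.

module Submission where

open import Defs
open import Data.Bool using (if_then_else_)
open import Data.Empty using (⊥-elim)
open import Data.Nat using (ℕ; zero; suc; _+_; _∸_; _<_; _≤_; z≤n; s≤s)
open import Data.Nat.Properties
  using (m+n∸m≡n; m+[n∸m]≡n; m≤m+n; n≤1+n; ≤-refl; <⇒≤; <⇒≱; <-irrefl; suc-injective; _≤?_)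
open import Data.List as L using ([]; _∷_; _++_; map)
open import Data.List.Properties
  using (map-∘; map-cong; map-id; map-id-local; map-++; ++-assoc; concatMap-map)
open import Data.List.Extrema.Nat using (max; xs≤max)
open import Data.List.Relation.Unary.All as All using (All; []; _∷_)
open import Data.List.Relation.Unary.All.Properties using () renaming (map⁺ to All-map⁺; ++⁺ to All-++⁺)
open import Data.List.Relation.Unary.Any using (here; there)
open import Data.List.Membership.Propositional using (_∈_; _∉_; find; lose)
open import Data.List.Membership.Propositional.Properties
  using (∈-map⁺; ∈-map⁻; ∈-++⁺ˡ; ∈-++⁺ʳ; ∈-++⁻; ∈-concatMap⁺; ∈-concatMap⁻)
open import Data.List.Membership.DecPropositional _≟T_ using (_∈?_)
open import Data.List.Relation.Binary.Subset.Propositional using (_⊆_)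
open import Data.List.Relation.Binary.Subset.Propositional.Properties
  using (⊆-refl; ⊆-trans; ⊆-reflexive; map⁺; concatMap⁺; ++⁺; xs⊆xs++ys; xs⊆x∷xs; ∷⁺ʳ; ∈-∷⁺ʳ)
open import Data.Product using (∃-syntax; _×_; _,_; proj₁; proj₂)
open import Data.Sum using (_⊎_; inj₁; inj₂)
open import Data.Vec as V using (Vec; []; _∷_)
open import Data.Vec.Properties using () renaming (map-cong to Vec-map-cong)
open import Function using (_∘_; _⇔_; mk⇔; id)
open import Function.Construct.Identity using (⇔-id)
open import Function.Related.TypeIsomorphisms using (¬-cong-⇔)
open import Relation.Nullary using (¬_; yes; no; ⌊_⌋)
open import Relation.Binary.PropositionalEquality
  using (_≡_; _≢_; _≗_; refl; trans; cong; cong₂; subst; subst₂; module ≡-Reasoning)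
import Relation.Binary.PropositionalEquality as ≡

_◂_ : {A : Set} → A → (ℕ → A) → ℕ → A
(a ◂ f) zero    = a
(a ◂ f) (suc n) = f n

≈F-refl : ∀ {X} → X ≈F X
≈F-refl = ⊆-refl , ⊆-refl

≈F-reflexive : ∀ {X Y} → X ≡ Y → X ≈F Y
≈F-reflexive refl = ≈F-refl

≈F-sym : ∀ {X Y} → X ≈F Y → Y ≈F X
≈F-sym (X⊆Y , Y⊆X) = Y⊆X , X⊆Y

≈F-trans : ∀ {X Y Z} → X ≈F Y → Y ≈F Z → X ≈F Z
≈F-trans (X⊆Y , Y⊆X) (Y⊆Z , Z⊆Y) = ⊆-trans X⊆Y Y⊆Z , ⊆-trans Z⊆Y Y⊆X

++-≈F : ∀ {X X' Y Y'} → X ≈F X' → Y ≈F Y' → (X ++ Y) ≈F (X' ++ Y')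
++-≈F (l , r) (l' , r') = ++⁺ l l' , ++⁺ r r'

∈-termsL⁻ : ∀ {t} X → t ∈ termsL X → ∃[ a ] (a ∈ X × t ∈ termsA a)
∈-termsL⁻ X t∈ = find (∈-concatMap⁻ termsA {xs = X} t∈)

∈-termsL⁺ : ∀ {t a X} → a ∈ X → t ∈ termsA a → t ∈ termsL X
∈-termsL⁺ a∈ t∈ = ∈-concatMap⁺ termsA (lose a∈ t∈)

applyL-cong : ∀ {σ σ'} → σ ≗ σ' → applyL σ ≗ applyL σ'
applyL-cong {σ} {σ'} eq = map-cong λ { (atom p n ts) → cong (atom p n) (Vec-map-cong applyT-cong ts) }
  where
  applyT-cong : applyT σ ≗ applyT σ'
  applyT-cong (cst _) = refl
  applyT-cong (nul _) = refl
  applyT-cong (var v) = eq v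

nul∉const : ∀ {a n} → DBFact a → nul n ∉ termsA a
nul∉const c n∈ with All.lookup c n∈
... | _ , ()

const⇒nullFree : ∀ X → All DBFact X → All NullFreeT (termsL X)
const⇒nullFree X cs = All.tabulate nullFree
  where
  nullFree : ∀ {t} → t ∈ termsL X → NullFreeT t
  nullFree t∈ n refl with ∈-termsL⁻ X t∈
  ... | a , a∈ , n∈ = nul∉const {a} (All.lookup cs a∈) n∈

map-fixes-consts : (f : Term → Term) → (∀ c → f (cst c) ≡ cst c) →
                   ∀ {n} (ts : Vec Term n) → All IsConst (V.toList ts) → V.map f ts ≡ ts
map-fixes-consts f fix []       _                  = refl
map-fixes-consts f fix (_ ∷ ts) ((c , refl) ∷ cs) = cong₂ _∷_ (fix c) (map-fixes-consts f fix ts cs)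

applyL-const : ∀ σ X → All DBFact X → applyL σ X ≡ X
applyL-const σ X cs = map-id-local (All.map (λ {a} → fixed a) cs)
  where
  fixed : ∀ a → DBFact a → applyA σ a ≡ a
  fixed (atom p n ts) c = cong (atom p n) (map-fixes-consts (applyT σ) (λ _ → refl) ts c)

-- applyHL h is definitionally map (applyHA h)
applyHA : (ℕ → Term) → Atom → Atom
applyHA h a = atom (sym a) (arity a) (V.map (applyH h) (args a))

applyHA-const : ∀ h {a} → DBFact a → applyHA h a ≡ a
applyHA-const h {atom p n ts} c = cong (atom p n) (map-fixes-consts (applyH h) (λ _ → refl) ts c)

applyHL-const : ∀ h X → All DBFact X → applyHL h X ≡ X
applyHL-const h X cs = map-id-local (All.map (applyHA-const h) cs)

Hom-mono : ∀ {h G G' C C'} → G' ⊆ G → C ⊆ C' → Hom h G C → Hom h G' C'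
Hom-mono {h} G'⊆G C⊆C' hom = ⊆-trans (map⁺ (applyHA h) G'⊆G) (⊆-trans hom C⊆C')

Hom-keeps-const : ∀ {h G C a} → Hom h G C → DBFact a → a ∈ G → a ∈ C
Hom-keeps-const {h} {G} hom c a∈ =
  hom (subst (_∈ applyHL h G) (applyHA-const h c) (∈-map⁺ (applyHA h) a∈))

IsCore-resp-≈F : ∀ {C C'} → C ≈F C' → IsCore C → IsCore C'
IsCore-resp-≈F (C⊆C' , C'⊆C) isCore h hom =
  ⊆-trans C'⊆C (⊆-trans (isCore h (Hom-mono C⊆C' C'⊆C hom)) (map⁺ (applyHA h) C⊆C'))

CoreOf-resp-≈F : ∀ {G G' C C'} → G ≈F G' → C ≈F C' → CoreOf G C → CoreOf G' C'
CoreOf-resp-≈F (G⊆G' , G'⊆G) (C⊆C' , C'⊆C) (C⊆G , (h , hom) , isCore) =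
  ⊆-trans C'⊆C (⊆-trans C⊆G G⊆G') , (h , Hom-mono G'⊆G C⊆C' hom) , IsCore-resp-≈F (C⊆C' , C'⊆C) isCore

const⇒CoreOf-self : ∀ {G} → All DBFact G → CoreOf G G
const⇒CoreOf-self {G} cs =
  ⊆-refl , (nul , ⊆-reflexive (applyHL-const nul G cs)) ,
  λ h _ → ⊆-reflexive (≡.sym (applyHL-const h G cs))

const-CoreOf⇒≈F : ∀ {G C} → All DBFact G → CoreOf G C → C ≈F G
const-CoreOf⇒≈F cs (C⊆G , (h , hom) , _) = C⊆G , λ a∈ → Hom-keeps-const hom (All.lookup cs a∈) a∈

rename : (ℕ → ℕ) → Atom → Atom
rename f a = atom (f (sym a)) (arity a) (args a)

module _ (f : ℕ → ℕ) where

  termsL-rename : ∀ X → termsL (map (rename f) X) ≡ termsL X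
  termsL-rename = concatMap-map termsA (rename f)

  applyL-rename : ∀ σ X → applyL σ (map (rename f) X) ≡ map (rename f) (applyL σ X)
  applyL-rename σ X = trans (≡.sym (map-∘ X)) (map-∘ X)

  applyHL-rename : ∀ h X → applyHL h (map (rename f) X) ≡ map (rename f) (applyHL h X)
  applyHL-rename h X = trans (≡.sym (map-∘ X)) (map-∘ X)

module Shift (k : ℕ) where

  ⇑ ⇓ : Atom → Atom
  ⇑ = rename (k +_)
  ⇓ = rename (_∸ k)

  ⇓-⇑ : ∀ a → ⇓ (⇑ a) ≡ a
  ⇓-⇑ a = cong (λ s → atom s (arity a) (args a)) (m+n∸m≡n k (sym a))

  ⇑-⇓ : ∀ {a} → k ≤ sym a → ⇑ (⇓ a) ≡ a
  ⇑-⇓ {a} k≤ = cong (λ s → atom s (arity a) (args a)) (m+[n∸m]≡n k≤)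

  ⇑-injective : ∀ {a b} → ⇑ a ≡ ⇑ b → a ≡ b
  ⇑-injective {a} {b} eq = trans (≡.sym (⇓-⇑ a)) (trans (cong ⇓ eq) (⇓-⇑ b))

  ⇑-above : ∀ a → k ≤ sym (⇑ a)
  ⇑-above a = m≤m+n k (sym a)

  map-⇓-⇑ : ∀ X → map ⇓ (map ⇑ X) ≡ X
  map-⇓-⇑ X = trans (≡.sym (map-∘ X)) (trans (map-cong ⇓-⇑ X) (map-id X))

  ∈-map-⇑⁻ : ∀ {a X} → ⇑ a ∈ map ⇑ X → a ∈ X
  ∈-map-⇑⁻ a∈ with ∈-map⁻ ⇑ a∈
  ... | b , b∈ , eq = subst (_∈ _) (≡.sym (⇑-injective eq)) b∈

  ⇑⁻¹ : FactSet → FactSet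
  ⇑⁻¹ []      = []
  ⇑⁻¹ (a ∷ X) with k ≤? sym a
  ... | yes _ = ⇓ a ∷ ⇑⁻¹ X
  ... | no _  = ⇑⁻¹ X

  ∈-⇑⁻¹⁺ : ∀ {a} X → ⇑ a ∈ X → a ∈ ⇑⁻¹ X
  ∈-⇑⁻¹⁺ (b ∷ X) a∈ with k ≤? sym b
  ∈-⇑⁻¹⁺ {a} (b ∷ X) (here refl) | yes _  = here (≡.sym (⇓-⇑ a))
  ∈-⇑⁻¹⁺     (b ∷ X) (there a∈)  | yes _  = there (∈-⇑⁻¹⁺ X a∈)
  ∈-⇑⁻¹⁺ {a} (b ∷ X) (here refl) | no k≰ = ⊥-elim (k≰ (⇑-above a))
  ∈-⇑⁻¹⁺     (b ∷ X) (there a∈)  | no _  = ∈-⇑⁻¹⁺ X a∈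

  ∈-⇑⁻¹⁻ : ∀ {a} X → a ∈ ⇑⁻¹ X → ⇑ a ∈ X
  ∈-⇑⁻¹⁻ (b ∷ X) a∈ with k ≤? sym b
  ∈-⇑⁻¹⁻ (b ∷ X) (here refl) | yes k≤ = here (⇑-⇓ k≤)
  ∈-⇑⁻¹⁻ (b ∷ X) (there a∈)  | yes _  = there (∈-⇑⁻¹⁻ X a∈)
  ∈-⇑⁻¹⁻ (b ∷ X) a∈          | no _   = there (∈-⇑⁻¹⁻ X a∈)

module Embedding (D' : FactSet) (D'-const : All DBFact D') where

  -- Start lies above every predicate of D' and ⇑ shifts above Start, so D', Start and ⇑F are disjoint
  Start : Atom
  Start = atom (suc (max 0 (map sym D'))) 0 []

  open Shift (suc (sym Start)) public

  embed : FactSet → FactSet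
  embed F = D' ++ Start ∷ map ⇑ F

  Base : FactSet
  Base = Start ∷ D'

  D'-below-Start : ∀ {a} → a ∈ D' → sym a < sym Start
  D'-below-Start a∈ = s≤s (All.lookup (xs≤max 0 (map sym D')) (∈-map⁺ sym a∈))

  Start∉D' : Start ∉ D'
  Start∉D' a∈ = <-irrefl refl (D'-below-Start a∈)

  Base-≤-Start : ∀ {a} → a ∈ Base → sym a ≤ sym Start
  Base-≤-Start (here refl) = ≤-refl
  Base-≤-Start (there a∈)  = <⇒≤ (D'-below-Start a∈)

  ⇑∉Base : ∀ a → ⇑ a ∉ Base
  ⇑∉Base a a∈ = <⇒≱ (⇑-above a) (Base-≤-Start a∈)

  Base-const : ∀ {a} → a ∈ Base → DBFact a
  Base-const (here refl) = []
  Base-const (there a∈)  = All.lookup D'-const a∈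

  Base⊆embed : ∀ F → Base ⊆ embed F
  Base⊆embed F (here refl) = ∈-++⁺ʳ D' (here refl)
  Base⊆embed F (there a∈)  = ∈-++⁺ˡ a∈

  ∈-embed⁻ : ∀ {a} F → a ∈ embed F → a ∈ Base ⊎ ∃[ b ] (b ∈ F × a ≡ ⇑ b)
  ∈-embed⁻ F a∈ with ∈-++⁻ D' a∈
  ... | inj₁ a∈D'         = inj₁ (there a∈D')
  ... | inj₂ (here refl)  = inj₁ (here refl)
  ... | inj₂ (there a∈⇑F) = inj₂ (∈-map⁻ ⇑ a∈⇑F)

  ⇑∈embed⁺ : ∀ {a F} → a ∈ F → ⇑ a ∈ embed F
  ⇑∈embed⁺ a∈ = ∈-++⁺ʳ D' (there (∈-map⁺ ⇑ a∈))

  ⇑∈embed⁻ : ∀ {a} F → ⇑ a ∈ embed F → a ∈ F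
  ⇑∈embed⁻ {a} F ⇑a∈ with ∈-embed⁻ F ⇑a∈
  ... | inj₁ ⇑a∈Base     = ⊥-elim (⇑∉Base a ⇑a∈Base)
  ... | inj₂ (b , b∈ , eq) = subst (_∈ F) (≡.sym (⇑-injective eq)) b∈

  ⇑-embed⁺ : ∀ {X F} → X ⊆ F → map ⇑ X ⊆ embed F
  ⇑-embed⁺ X⊆F = ∈-++⁺ʳ D' ∘ there ∘ map⁺ ⇑ X⊆F

  ⇑-embed⁻ : ∀ {X F} → map ⇑ X ⊆ embed F → X ⊆ F
  ⇑-embed⁻ {F = F} ⇑X⊆ = ⇑∈embed⁻ F ∘ ⇑X⊆ ∘ ∈-map⁺ ⇑

  embed-⊆ : ∀ {F G} → F ⊆ G → embed F ⊆ embed G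
  embed-⊆ F⊆G = ++⁺ ⊆-refl (∷⁺ʳ Start (map⁺ ⇑ F⊆G))

  embed-⊆⁻ : ∀ {F G} → embed F ⊆ embed G → F ⊆ G
  embed-⊆⁻ ⊆ = ⇑-embed⁻ (⊆ ∘ ⇑-embed⁺ ⊆-refl)

  embed-≈F : ∀ {F G} → F ≈F G → embed F ≈F embed G
  embed-≈F (F⊆G , G⊆F) = embed-⊆ F⊆G , embed-⊆ G⊆F

  embed-++ : ∀ F O → embed (F ++ O) ≡ embed F ++ map ⇑ O
  embed-++ F O = begin
    D' ++ Start ∷ map ⇑ (F ++ O)        ≡⟨ cong (λ X → D' ++ Start ∷ X) (map-++ ⇑ F O) ⟩
    D' ++ (Start ∷ map ⇑ F) ++ map ⇑ O  ≡⟨ ++-assoc D' (Start ∷ map ⇑ F) (map ⇑ O) ⟨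
    embed F ++ map ⇑ O                  ∎
    where open ≡-Reasoning

  embed-const : ∀ {F} → All DBFact F → All DBFact (embed F)
  embed-const F-const = All-++⁺ D'-const ([] ∷ All-map⁺ F-const)

  applyL-⇑-embed⁺ : ∀ σ X {F} → applyL σ X ⊆ F → applyL σ (map ⇑ X) ⊆ embed F
  applyL-⇑-embed⁺ σ X ⊆F = subst (_⊆ embed _) (≡.sym (applyL-rename _ σ X)) (⇑-embed⁺ ⊆F)

  applyL-⇑-embed⁻ : ∀ σ X {F} → applyL σ (map ⇑ X) ⊆ embed F → applyL σ X ⊆ F
  applyL-⇑-embed⁻ σ X ⊆embed = ⇑-embed⁻ (subst (_⊆ embed _) (applyL-rename _ σ X) ⊆embed)

  nul∈embed⁺ : ∀ {n} F → nul n ∈ termsL F → nul n ∈ termsL (embed F)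
  nul∈embed⁺ F n∈ with ∈-termsL⁻ F n∈
  ... | a , a∈ , n∈a = ∈-termsL⁺ (⇑∈embed⁺ a∈) n∈a

  nul∈embed⁻ : ∀ {n} F → nul n ∈ termsL (embed F) → nul n ∈ termsL F
  nul∈embed⁻ F n∈ with ∈-termsL⁻ (embed F) n∈
  ... | a , a∈ , n∈a with ∈-embed⁻ F a∈
  ...   | inj₁ a∈Base          = ⊥-elim (nul∉const {a} (Base-const a∈Base) n∈a)
  ...   | inj₂ (b , b∈ , refl) = ∈-termsL⁺ b∈ n∈a

  ⇑⁻¹-embed : ∀ {F' F} → F' ≈F embed F → ⇑⁻¹ F' ≈F F
  ⇑⁻¹-embed {F'} {F} (F'⊆ , ⊆F') = ⇑∈embed⁻ F ∘ F'⊆ ∘ ∈-⇑⁻¹⁻ F' , ∈-⇑⁻¹⁺ F' ∘ ⊆F' ∘ ⇑∈embed⁺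

  embed-⇑⁻¹ : ∀ {F' F} → F' ≈F embed F → F' ≈F embed (⇑⁻¹ F')
  embed-⇑⁻¹ F'≈ = ≈F-trans F'≈ (embed-≈F (≈F-sym (⇑⁻¹-embed F'≈)))

  Base⊆⇒embed-⇑⁻¹ : ∀ {X} → Base ⊆ X → (∀ {a} → a ∈ X → a ∈ Base ⊎ ∃[ b ] a ≡ ⇑ b) →
                    X ≈F embed (⇑⁻¹ X)
  Base⊆⇒embed-⇑⁻¹ {X} Base⊆X shape = to , from
    where
    to : X ⊆ embed (⇑⁻¹ X)
    to a∈ with shape a∈
    ... | inj₁ a∈Base   = Base⊆embed _ a∈Base
    ... | inj₂ (b , refl) = ⇑∈embed⁺ (∈-⇑⁻¹⁺ X a∈)
    from : embed (⇑⁻¹ X) ⊆ X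
    from a∈ with ∈-embed⁻ (⇑⁻¹ X) a∈
    ... | inj₁ a∈Base        = Base⊆X a∈Base
    ... | inj₂ (b , b∈ , refl) = ∈-⇑⁻¹⁻ X b∈

  applyHL-embed : ∀ h F → applyHL h (embed F) ≡ embed (applyHL h F)
  applyHL-embed h F = begin
    applyHL h (D' ++ Start ∷ map ⇑ F)                  ≡⟨ map-++ (applyHA h) D' (Start ∷ map ⇑ F) ⟩
    applyHL h D' ++ Start ∷ applyHL h (map ⇑ F)        ≡⟨ cong₂ (λ X Y → X ++ Start ∷ Y)
                                                            (applyHL-const h D' D'-const) (applyHL-rename _ h F) ⟩
    D' ++ Start ∷ map ⇑ (applyHL h F)                  ∎
    where open ≡-Reasoning

  Hom-embed⁺ : ∀ {h G C} → Hom h G C → Hom h (embed G) (embed C)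
  Hom-embed⁺ {h} {G} {C} hom = subst (_⊆ embed C) (≡.sym (applyHL-embed h G)) (embed-⊆ hom)

  Hom-embed⁻ : ∀ {h G C} → Hom h (embed G) (embed C) → Hom h G C
  Hom-embed⁻ {h} {G} {C} hom = embed-⊆⁻ (subst (_⊆ embed C) (applyHL-embed h G) hom)

  IsCore-embed⁺ : ∀ {C} → IsCore C → IsCore (embed C)
  IsCore-embed⁺ {C} isCore h hom =
    subst (embed C ⊆_) (≡.sym (applyHL-embed h C)) (embed-⊆ (isCore h (Hom-embed⁻ hom)))

  IsCore-embed⁻ : ∀ {C} → IsCore (embed C) → IsCore C
  IsCore-embed⁻ {C} isCore h hom =
    embed-⊆⁻ (subst (embed C ⊆_) (applyHL-embed h C) (isCore h (Hom-embed⁺ hom)))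

  CoreOf-embed⁺ : ∀ {G C} → CoreOf G C → CoreOf (embed G) (embed C)
  CoreOf-embed⁺ (C⊆G , (h , hom) , isCore) = embed-⊆ C⊆G , (h , Hom-embed⁺ hom) , IsCore-embed⁺ isCore

  CoreOf-embed⁻ : ∀ {G C} → CoreOf (embed G) (embed C) → CoreOf G C
  CoreOf-embed⁻ (C⊆G , (h , hom) , isCore) = embed-⊆⁻ C⊆G , (h , Hom-embed⁻ hom) , IsCore-embed⁻ isCore

Applies : FactSet → Trigger → (ℕ → ℕ) → FactSet → Set
Applies F t ν F₁ = Fresh F t ν × F₁ ≈F (F ++ output t ν)

Applies-⊆ : ∀ {F t ν F₁} → Applies F t ν F₁ → F ⊆ F₁
Applies-⊆ {F} (_ , _ , ⊆F₁) = ⊆-trans (xs⊆xs++ys F _) ⊆F₁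

InPar : RuleSet → FactSet → (Trigger → ℕ → ℕ) → Atom → Set
InPar Σr F N a = a ∈ F ⊎ ∃[ t ] (Active Σr F t × a ∈ output t (N t))

ParStep-⊆ : ∀ {Σr F G} → ParStep Σr F G → F ⊆ G
ParStep-⊆ (_ , _ , _ , _ , memb) a∈ = proj₂ (memb _) (inj₁ a∈)

CoreStep-keeps-const : ∀ {Σr F C X} → All DBFact X → X ⊆ F → CoreStep Σr F C → X ⊆ C
CoreStep-keeps-const {Σr} X-const X⊆F (_ , par , _ , (_ , hom) , _) a∈ =
  Hom-keeps-const hom (All.lookup X-const a∈) (ParStep-⊆ {Σr} par (X⊆F a∈))

facts : Database → FactSet
facts = proj₁

module Reduction (D' : Database) (Σr : RuleSet) (D : Database) where

  open Embedding (facts D') (proj₂ D')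

  liftRule : Rule → Rule
  liftRule R = rule (Start ∷ map ⇑ (body R)) (map ⇑ (head R))

  unliftRule : Rule → Rule
  unliftRule R = rule (map ⇓ (L.drop 1 (body R))) (map ⇓ (head R))

  initRule : Rule
  initRule = rule [] (Start ∷ map ⇑ (facts D))

  unlift-liftRule : ∀ R → unliftRule (liftRule R) ≡ R
  unlift-liftRule R = cong₂ rule (map-⇓-⇑ (body R)) (map-⇓-⇑ (head R))

  liftRule≢initRule : ∀ R → liftRule R ≢ initRule
  liftRule≢initRule R ()

  head-initRule-const : All DBFact (head initRule)
  head-initRule-const = [] ∷ All-map⁺ (proj₂ D)

  termsL-body-lift : ∀ R → termsL (body (liftRule R)) ≡ termsL (body R)
  termsL-body-lift R = termsL-rename _ (body R)

  termsL-head-lift : ∀ R → termsL (head (liftRule R)) ≡ termsL (head R)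
  termsL-head-lift R = termsL-rename _ (head R)

  termsL-body-unlift : ∀ R → termsL (body (unliftRule R)) ⊆ termsL (body R)
  termsL-body-unlift R =
    subst (_⊆ termsL (body R)) (≡.sym (termsL-rename _ (L.drop 1 (body R))))
          (concatMap⁺ termsA (drop1⊆ (body R)))
    where
    drop1⊆ : ∀ X → L.drop 1 X ⊆ X
    drop1⊆ []      = id
    drop1⊆ (a ∷ X) = xs⊆x∷xs X a

  WFRule-lift : ∀ {R} → WFRule R → WFRule (liftRule R)
  WFRule-lift {R} (body-nf , head-nf , head≢[]) =
    subst (All NullFreeT) (≡.sym (termsL-body-lift R)) body-nf ,
    subst (All NullFreeT) (≡.sym (termsL-head-lift R)) head-nf ,
    head≢[] ∘ map-≡[]
    where
    map-≡[] : ∀ {X} → map ⇑ X ≡ [] → X ≡ []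
    map-≡[] {[]} _ = refl

  WFRule-init : WFRule initRule
  WFRule-init = [] , const⇒nullFree (head initRule) head-initRule-const , λ ()

  Σ' : RuleSet
  Σ' = initRule ∷ map liftRule (proj₁ Σr) ,
       WFRule-init ∷ All-map⁺ (All.map (λ {R} → WFRule-lift {R}) (proj₂ Σr))

  lift unlift : Trigger → Trigger
  lift   t = trig (liftRule (trule t)) (tsub t)
  unlift t = trig (unliftRule (trule t)) (tsub t)

  unlift-lift : ∀ t → unlift (lift t) ≡ t
  unlift-lift t = cong (λ R → trig R (tsub t)) (unlift-liftRule (trule t))

  initTrigger : Trigger
  initTrigger = trig initRule (λ _ → cst 0)

  TrigOf-lift : ∀ {t} → TrigOf Σr t → TrigOf Σ' (lift t)
  TrigOf-lift o = there (∈-map⁺ liftRule o)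

  origin : ∀ {t} → TrigOf Σ' t → trule t ≡ initRule ⊎ ∃[ t₀ ] (t ≡ lift t₀ × TrigOf Σr t₀)
  origin (here eq) = inj₁ eq
  origin {trig R σ} (there o) with ∈-map⁻ liftRule o
  ... | R₀ , R₀∈ , refl = inj₂ (trig R₀ σ , refl , R₀∈)

  liftRule-injective : ∀ {R R'} → liftRule R ≡ liftRule R' → R ≡ R'
  liftRule-injective {R} {R'} eq =
    trans (≡.sym (unlift-liftRule R)) (trans (cong unliftRule eq) (unlift-liftRule R'))

  TrigOf-lift⁻ : ∀ {t} → TrigOf Σ' (lift t) → TrigOf Σr t
  TrigOf-lift⁻ {t} (here eq) = ⊥-elim (liftRule≢initRule (trule t) eq)
  TrigOf-lift⁻ (there o) with ∈-map⁻ liftRule o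
  ... | R₀ , R₀∈ , eq = subst (_∈ proj₁ Σr) (≡.sym (liftRule-injective eq)) R₀∈

  UVar-lift⁺ : ∀ R {v} → UVar R v → UVar (liftRule R) v
  UVar-lift⁺ R = subst (_ ∈_) (≡.sym (termsL-body-lift R))

  UVar-lift⁻ : ∀ R {v} → UVar (liftRule R) v → UVar R v
  UVar-lift⁻ R = subst (_ ∈_) (termsL-body-lift R)

  EVar-lift⁺ : ∀ R {v} → EVar R v → EVar (liftRule R) v
  EVar-lift⁺ R (v∈ , ¬uvar) = subst (_ ∈_) (≡.sym (termsL-head-lift R)) v∈ , ¬uvar ∘ UVar-lift⁻ R

  EVar-lift⁻ : ∀ R {v} → EVar (liftRule R) v → EVar R v
  EVar-lift⁻ R (v∈ , ¬uvar) = subst (_ ∈_) (termsL-head-lift R) v∈ , ¬uvar ∘ UVar-lift⁺ R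

  ¬UVar-init : ∀ {R v} → R ≡ initRule → ¬ UVar R v
  ¬UVar-init refl ()

  ¬EVar-init : ∀ {R v} → R ≡ initRule → ¬ EVar R v
  ¬EVar-init {v = v} refl (v∈ , _) with ∈-termsL⁻ (head initRule) v∈
  ... | a , a∈ , v∈a with All.lookup (All.lookup head-initRule-const a∈) v∈a
  ...   | _ , ()

  TrigEq-lift⁺ : ∀ {t t'} → TrigEq t t' → TrigEq (lift t) (lift t')
  TrigEq-lift⁺ {t} (eq , agree) = cong liftRule eq , λ v → agree v ∘ UVar-lift⁻ (trule t)

  TrigEq-lift⁻ : ∀ {t t'} → TrigEq (lift t) (lift t') → TrigEq t t'
  TrigEq-lift⁻ {t} (eq , agree) = liftRule-injective eq , λ v → agree v ∘ UVar-lift⁺ (trule t)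

  TrigEq-unlift : ∀ {t t'} → TrigEq t t' → TrigEq (unlift t) (unlift t')
  TrigEq-unlift {t} (eq , agree) = cong unliftRule eq , λ v → agree v ∘ termsL-body-unlift (trule t)

  TrigEq-init : ∀ {t t'} → trule t ≡ initRule → trule t' ≡ initRule → TrigEq t t'
  TrigEq-init init init' = trans init (≡.sym init') , λ v uvar → ⊥-elim (¬UVar-init init uvar)

  lift≉init : ∀ {t t'} → trule t' ≡ initRule → ¬ TrigEq (lift t) t'
  lift≉init {t} init (eq , _) = liftRule≢initRule (trule t) (trans eq init)

  init≉lift : ∀ {t t'} → trule t' ≡ initRule → ¬ TrigEq t' (lift t)
  init≉lift {t} init (eq , _) = liftRule≢initRule (trule t) (trans (≡.sym eq) init)

  output-lift : ∀ t ν → output (lift t) ν ≡ map ⇑ (output t ν)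
  output-lift (trig R σ) ν = begin
    applyL (extend (liftRule R) σ ν) (map ⇑ (head R))  ≡⟨ applyL-rename _ _ (head R) ⟩
    map ⇑ (applyL (extend (liftRule R) σ ν) (head R))  ≡⟨ cong (map ⇑) (applyL-cong extend-lift (head R)) ⟩
    map ⇑ (applyL (extend R σ ν) (head R))             ∎
    where
    open ≡-Reasoning
    extend-lift : extend (liftRule R) σ ν ≗ extend R σ ν
    extend-lift v = cong (λ X → if ⌊ var v ∈? X ⌋ then σ v else nul (ν v)) (termsL-body-lift R)

  output-init : ∀ {t ν} → trule t ≡ initRule → output t ν ≡ head initRule
  output-init {trig _ σ} {ν} refl = applyL-const (extend initRule σ ν) (head initRule) head-initRule-const

  Loaded-lift⁺ : ∀ {F' F t} → F' ≈F embed F → Loaded t F → Loaded (lift t) F'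
  Loaded-lift⁺ {F = F} {trig R σ} (_ , embed⊆F') l =
    ⊆-trans (∈-∷⁺ʳ (Base⊆embed F (here refl)) (applyL-⇑-embed⁺ σ (body R) l)) embed⊆F'

  Loaded-lift⁻ : ∀ {F' F t} → F' ≈F embed F → Loaded (lift t) F' → Loaded t F
  Loaded-lift⁻ {t = trig R σ} (F'⊆embed , _) l =
    applyL-⇑-embed⁻ σ (body R) (⊆-trans (l ∘ there) F'⊆embed)

  Obsolete-lift⁺ : ∀ {F' F t} → F' ≈F embed F → Obsolete t F → Obsolete (lift t) F'
  Obsolete-lift⁺ {t = trig R σ} (_ , embed⊆F') (σ' , agree , head⊆) =
    σ' , (λ v → agree v ∘ UVar-lift⁻ R) , ⊆-trans (applyL-⇑-embed⁺ σ' (head R) head⊆) embed⊆F'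

  Obsolete-lift⁻ : ∀ {F' F t} → F' ≈F embed F → Obsolete (lift t) F' → Obsolete t F
  Obsolete-lift⁻ {t = trig R σ} (F'⊆embed , _) (σ' , agree , head⊆) =
    σ' , (λ v → agree v ∘ UVar-lift⁺ R) , applyL-⇑-embed⁻ σ' (head R) (⊆-trans head⊆ F'⊆embed)

  Fresh-lift⁺ : ∀ {F' F t ν} → F' ≈F embed F → Fresh F t ν → Fresh F' (lift t) ν
  Fresh-lift⁺ {F = F} {trig R σ} (F'⊆embed , _) (injective , fresh) =
    (λ u w eu ew → injective u w (EVar-lift⁻ R eu) (EVar-lift⁻ R ew)) ,
    (λ u eu → fresh u (EVar-lift⁻ R eu) ∘ nul∈embed⁻ F ∘ concatMap⁺ termsA F'⊆embed)

  Fresh-lift⁻ : ∀ {F' F t ν} → F' ≈F embed F → Fresh F' (lift t) ν → Fresh F t ν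
  Fresh-lift⁻ {F = F} {trig R σ} (_ , embed⊆F') (injective , fresh) =
    (λ u w eu ew → injective u w (EVar-lift⁺ R eu) (EVar-lift⁺ R ew)) ,
    (λ u eu → fresh u (EVar-lift⁺ R eu) ∘ concatMap⁺ termsA embed⊆F' ∘ nul∈embed⁺ F)

  Active-lift⁺ : ∀ {F' F t} → F' ≈F embed F → Active Σr F t → Active Σ' F' (lift t)
  Active-lift⁺ {t = t} F'≈ (o , l , ¬obsolete) =
    TrigOf-lift {t} o , Loaded-lift⁺ {t = t} F'≈ l , ¬obsolete ∘ Obsolete-lift⁻ {t = t} F'≈

  Active-lift⁻ : ∀ {F' F t} → F' ≈F embed F → Active Σ' F' (lift t) → Active Σr F t
  Active-lift⁻ {t = t} F'≈ (o , l , ¬obsolete) =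
    TrigOf-lift⁻ {t} o , Loaded-lift⁻ {t = t} F'≈ l , ¬obsolete ∘ Obsolete-lift⁺ {t = t} F'≈

  Simulates : FactSet → FactSet → Set
  Simulates F' F = F' ≈F embed F × facts D ⊆ F

  Simulates-init : ∀ {F₁} → F₁ ≈F embed (facts D) → Simulates F₁ (⇑⁻¹ F₁)
  Simulates-init F₁≈ = embed-⇑⁻¹ F₁≈ , proj₂ (⇑⁻¹-embed F₁≈)

  init-obsolete : ∀ {F' F t} → Simulates F' F → trule t ≡ initRule → Obsolete t F'
  init-obsolete {F'} {F} {trig _ σ} ((_ , embed⊆F') , D⊆F) refl =
    σ , (λ _ _ → refl) ,
    subst (_⊆ F') (≡.sym (applyL-const σ (head initRule) head-initRule-const))
          (⊆-trans (∈-∷⁺ʳ (Base⊆embed F (here refl)) (⇑-embed⁺ D⊆F)) embed⊆F')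

  active-lifted : ∀ {F' F t} → Simulates F' F → Active Σ' F' t →
                  ∃[ t₀ ] (t ≡ lift t₀ × Active Σr F t₀)
  active-lifted {t = t} s (o , l , ¬obsolete) with origin {t} o
  ... | inj₁ init           = ⊥-elim (¬obsolete (init-obsolete s init))
  ... | inj₂ (t₀ , refl , _) = t₀ , refl , Active-lift⁻ {t = t₀} (proj₁ s) (o , l , ¬obsolete)

  Start∉≈D' : ∀ {F₀} → F₀ ≈F facts D' → Start ∉ F₀
  Start∉≈D' (F₀⊆D' , _) = Start∉D' ∘ F₀⊆D'

  loaded-on-D'⇒init : ∀ {F₀ t} → F₀ ≈F facts D' → TrigOf Σ' t → Loaded t F₀ → trule t ≡ initRule
  loaded-on-D'⇒init {t = t} F₀≈ o l with origin {t} o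
  ... | inj₁ init           = init
  ... | inj₂ (_ , refl , _) = ⊥-elim (Start∉≈D' F₀≈ (l (here refl)))

  initTrigger-active : ∀ {F₀} → F₀ ≈F facts D' → Active Σ' F₀ initTrigger
  initTrigger-active F₀≈ = here refl , (λ ()) , λ (_ , _ , head⊆) → Start∉≈D' F₀≈ (head⊆ (here refl))

  init-fresh : ∀ {F t ν} → trule t ≡ initRule → Fresh F t ν
  init-fresh init = (λ _ _ eu → ⊥-elim (¬EVar-init init eu)) , λ _ eu → ⊥-elim (¬EVar-init init eu)

  Applies-init : ∀ {F₀ ν} → F₀ ≈F facts D → Applies (facts D') initTrigger ν (embed F₀)
  Applies-init F₀≈ =
    init-fresh {facts D'} {initTrigger} refl ,
    ≈F-trans (embed-≈F F₀≈) (≈F-reflexive (cong (facts D' ++_) (≡.sym (output-init {initTrigger} refl))))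

  Applies-init⁻ : ∀ {F₀ t ν F₁} → F₀ ≈F facts D' → trule t ≡ initRule → Applies F₀ t ν F₁ →
                  F₁ ≈F embed (facts D)
  Applies-init⁻ F₀≈ init (_ , F₁≈) = ≈F-trans F₁≈ (++-≈F F₀≈ (≈F-reflexive (output-init init)))

  Applies-lift : ∀ {F t ν F₁} → Applies F t ν F₁ → Applies (embed F) (lift t) ν (embed F₁)
  Applies-lift {F} {t} {ν} (fresh , F₁≈) =
    Fresh-lift⁺ {t = t} ≈F-refl fresh ,
    ≈F-trans (embed-≈F F₁≈)
             (≈F-reflexive (trans (embed-++ F (output t ν)) (cong (embed F ++_) (≡.sym (output-lift t ν)))))

  Applies-unlift : ∀ {F' F t ν F''} → Simulates F' F → Applies F' (lift t) ν F'' →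
                   Applies F t ν (⇑⁻¹ F'') × Simulates F'' (⇑⁻¹ F'')
  Applies-unlift {F = F} {t} {ν} {F''} (F'≈ , D⊆F) (fresh , F''≈) =
    (Fresh-lift⁻ {t = t} F'≈ fresh , ⇑⁻¹-embed F''≈embed) ,
    embed-⇑⁻¹ F''≈embed , ⊆-trans D⊆F (⊆-trans (xs⊆xs++ys F _) (proj₂ (⇑⁻¹-embed F''≈embed)))
    where
    F''≈embed : F'' ≈F embed (F ++ output t ν)
    F''≈embed = ≈F-trans F''≈ (≈F-trans (++-≈F F'≈ (≈F-reflexive (output-lift t ν)))
                                         (≈F-reflexive (≡.sym (embed-++ F (output t ν)))))

  -- Restricted chase

  RStep-init : ∀ {F₀ ν} → F₀ ≈F facts D → RStep Σ' (facts D') initTrigger ν (embed F₀)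
  RStep-init F₀≈ = initTrigger-active ≈F-refl , Applies-init F₀≈

  RStep-lift : ∀ {F t ν F₁} → RStep Σr F t ν F₁ → RStep Σ' (embed F) (lift t) ν (embed F₁)
  RStep-lift {t = t} (active , app) = Active-lift⁺ {t = t} ≈F-refl active , Applies-lift {t = t} app

  RStep-init⁻ : ∀ {F₀ t ν F₁} → F₀ ≈F facts D' → RStep Σ' F₀ t ν F₁ → F₁ ≈F embed (facts D)
  RStep-init⁻ F₀≈ ((o , l , _) , app) = Applies-init⁻ F₀≈ (loaded-on-D'⇒init F₀≈ o l) app

  RStep-unlift : ∀ {F' F t ν F''} → Simulates F' F → RStep Σ' F' t ν F'' →
                 RStep Σr F (unlift t) ν (⇑⁻¹ F'') × Simulates F'' (⇑⁻¹ F'')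
  RStep-unlift {F = F} {ν = ν} {F''} s (active , app) with active-lifted s active
  ... | t₀ , refl , active₀ =
    let app₀ , s'' = Applies-unlift {t = t₀} s app
    in subst (λ t → RStep Σr F t ν (⇑⁻¹ F'')) (≡.sym (unlift-lift t₀)) (active₀ , app₀) , s''

  rest-finite⁺ : FiniteRest (Σr , D) → FiniteRest (Σ' , D')
  rest-finite⁺ (n , F , T , N , F₀≈ , steps , fair) = suc n , F' , T' , N' , ≈F-refl , steps' , fair'
    where
    F' = facts D' ◂ (embed ∘ F)
    T' = initTrigger ◂ (lift ∘ T)
    N' = (λ _ → 0) ◂ N

    D⊆F : ∀ i → i ≤ n → facts D ⊆ F i
    D⊆F zero    _   = proj₂ F₀≈
    D⊆F (suc i) i<n = ⊆-trans (D⊆F i (<⇒≤ i<n)) (Applies-⊆ {t = T i} (proj₂ (steps i i<n)))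

    steps' : ∀ i → i < suc n → RStep Σ' (F' i) (T' i) (N' i) (F' (suc i))
    steps' zero    _         = RStep-init F₀≈
    steps' (suc i) (s≤s i<n) = RStep-lift {t = T i} (steps i i<n)

    fair' : ∀ t → TrigOf Σ' t → ∀ i → i ≤ suc n → Loaded t (F' i) →
            ∃[ j ] (i ≤ j × j ≤ suc n × Obsolete t (F' j))
    fair' t o i i≤ l with origin {t} o
    ... | inj₁ init = suc n , i≤ , ≤-refl , init-obsolete (≈F-refl , D⊆F n ≤-refl) init
    fair' _ _ zero    _          l | inj₂ (_ , refl , _) = ⊥-elim (Start∉D' (l (here refl)))
    fair' _ _ (suc i) (s≤s i≤n) l | inj₂ (t₀ , refl , o₀) =
      let j , i≤j , j≤n , obsolete = fair t₀ o₀ i i≤n (Loaded-lift⁻ {t = t₀} ≈F-refl l)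
      in suc j , s≤s i≤j , s≤s j≤n , Obsolete-lift⁺ {t = t₀} ≈F-refl obsolete

  rest-finite⁻ : FiniteRest (Σ' , D') → FiniteRest (Σr , D)
  rest-finite⁻ (zero , F' , T' , N' , F'₀≈ , steps , fair)
    with fair initTrigger (here refl) 0 z≤n (λ ())
  ... | .0 , _ , z≤n , (_ , _ , head⊆) = ⊥-elim (Start∉≈D' F'₀≈ (head⊆ (here refl)))
  rest-finite⁻ (suc n , F' , T' , N' , F'₀≈ , steps , fair) = n , F , T , N , F₀≈ , steps' , fair'
    where
    F = λ k → ⇑⁻¹ (F' (suc k))
    T = λ k → unlift (T' (suc k))
    N = λ k → N' (suc k)

    F'₁≈ : F' 1 ≈F embed (facts D)
    F'₁≈ = RStep-init⁻ F'₀≈ (steps 0 (s≤s z≤n))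

    F₀≈ : F 0 ≈F facts D
    F₀≈ = ⇑⁻¹-embed F'₁≈

    simulates : ∀ k → k ≤ n → Simulates (F' (suc k)) (F k)
    simulates zero    _   = Simulates-init F'₁≈
    simulates (suc k) k<n = proj₂ (RStep-unlift (simulates k (<⇒≤ k<n)) (steps (suc k) (s≤s k<n)))

    steps' : ∀ i → i < n → RStep Σr (F i) (T i) (N i) (F (suc i))
    steps' k k<n = proj₁ (RStep-unlift (simulates k (<⇒≤ k<n)) (steps (suc k) (s≤s k<n)))

    fair' : ∀ t → TrigOf Σr t → ∀ i → i ≤ n → Loaded t (F i) →
            ∃[ j ] (i ≤ j × j ≤ n × Obsolete t (F j))
    fair' t o i i≤n l
      with fair (lift t) (TrigOf-lift {t} o) (suc i) (s≤s i≤n) (Loaded-lift⁺ {t = t} (proj₁ (simulates i i≤n)) l)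
    ... | suc j , s≤s i≤j , s≤s j≤n , obsolete =
      j , i≤j , j≤n , Obsolete-lift⁻ {t = t} (proj₁ (simulates j j≤n)) obsolete

  rest-infinite⁺ : InfiniteRest (Σr , D) → InfiniteRest (Σ' , D')
  rest-infinite⁺ (F , T , N , F₀≈ , steps , fair) = F' , T' , N' , ≈F-refl , steps' , fair'
    where
    F' = facts D' ◂ (embed ∘ F)
    T' = initTrigger ◂ (lift ∘ T)
    N' = (λ _ → 0) ◂ N

    D⊆F : ∀ i → facts D ⊆ F i
    D⊆F zero    = proj₂ F₀≈
    D⊆F (suc i) = ⊆-trans (D⊆F i) (Applies-⊆ {t = T i} (proj₂ (steps i)))

    steps' : ∀ i → RStep Σ' (F' i) (T' i) (N' i) (F' (suc i))
    steps' zero    = RStep-init F₀≈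
    steps' (suc i) = RStep-lift {t = T i} (steps i)

    fair' : ∀ t → TrigOf Σ' t → ∀ i → Loaded t (F' i) → ∃[ j ] (i ≤ j × Obsolete t (F' j))
    fair' t o i l with origin {t} o
    ... | inj₁ init = suc i , n≤1+n i , init-obsolete (≈F-refl , D⊆F i) init
    fair' _ _ zero    l | inj₂ (_ , refl , _) = ⊥-elim (Start∉D' (l (here refl)))
    fair' _ _ (suc i) l | inj₂ (t₀ , refl , o₀) =
      let j , i≤j , obsolete = fair t₀ o₀ i (Loaded-lift⁻ {t = t₀} ≈F-refl l)
      in suc j , s≤s i≤j , Obsolete-lift⁺ {t = t₀} ≈F-refl obsolete

  rest-infinite⁻ : InfiniteRest (Σ' , D') → InfiniteRest (Σr , D)
  rest-infinite⁻ (F' , T' , N' , F'₀≈ , steps , fair) = F , T , N , F₀≈ , steps' , fair'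
    where
    F = λ k → ⇑⁻¹ (F' (suc k))
    T = λ k → unlift (T' (suc k))
    N = λ k → N' (suc k)

    F'₁≈ : F' 1 ≈F embed (facts D)
    F'₁≈ = RStep-init⁻ F'₀≈ (steps 0)

    F₀≈ : F 0 ≈F facts D
    F₀≈ = ⇑⁻¹-embed F'₁≈

    simulates : ∀ k → Simulates (F' (suc k)) (F k)
    simulates zero    = Simulates-init F'₁≈
    simulates (suc k) = proj₂ (RStep-unlift (simulates k) (steps (suc k)))

    steps' : ∀ i → RStep Σr (F i) (T i) (N i) (F (suc i))
    steps' k = proj₁ (RStep-unlift (simulates k) (steps (suc k)))

    fair' : ∀ t → TrigOf Σr t → ∀ i → Loaded t (F i) → ∃[ j ] (i ≤ j × Obsolete t (F j))
    fair' t o i l with fair (lift t) (TrigOf-lift {t} o) (suc i) (Loaded-lift⁺ {t = t} (proj₁ (simulates i)) l)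
    ... | suc j , s≤s i≤j , obsolete = j , i≤j , Obsolete-lift⁻ {t = t} (proj₁ (simulates j)) obsolete

  -- Oblivious chase

  OStep-init : ∀ {F₀ ν} → F₀ ≈F facts D → OStep Σ' (facts D') initTrigger ν (embed F₀)
  OStep-init F₀≈ = here refl , (λ ()) , Applies-init F₀≈

  OStep-lift : ∀ {F t ν F₁} → OStep Σr F t ν F₁ → OStep Σ' (embed F) (lift t) ν (embed F₁)
  OStep-lift {t = t} (o , l , app) =
    TrigOf-lift {t} o , Loaded-lift⁺ {t = t} ≈F-refl l , Applies-lift {t = t} app

  OStep-init⁻ : ∀ {F₀ t ν F₁} → F₀ ≈F facts D' → OStep Σ' F₀ t ν F₁ →
                trule t ≡ initRule × F₁ ≈F embed (facts D)
  OStep-init⁻ F₀≈ (o , l , app) = init , Applies-init⁻ F₀≈ init app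
    where init = loaded-on-D'⇒init F₀≈ o l

  OStep-unlift : ∀ {F' F t ν F''} → Simulates F' F → OStep Σ' F' (lift t) ν F'' →
                 OStep Σr F t ν (⇑⁻¹ F'') × Simulates F'' (⇑⁻¹ F'')
  OStep-unlift {t = t} s (o , l , app) =
    let app₀ , s'' = Applies-unlift {t = t} s app
    in (TrigOf-lift⁻ {t} o , Loaded-lift⁻ {t = t} (proj₁ s) l , app₀) , s''

  lifted : ∀ {t} → TrigOf Σ' t → trule t ≢ initRule → t ≡ lift (unlift t)
  lifted {t} o ¬init with origin {t} o
  ... | inj₁ init           = ⊥-elim (¬init init)
  ... | inj₂ (t₀ , refl , _) = cong lift (≡.sym (unlift-lift t₀))

  obl-finite⁺ : FiniteObl (Σr , D) → FiniteObl (Σ' , D')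
  obl-finite⁺ (n , F , T , N , F₀≈ , steps , distinct , fair) =
    suc n , F' , T' , N' , ≈F-refl , steps' , distinct' , fair'
    where
    F' = facts D' ◂ (embed ∘ F)
    T' = initTrigger ◂ (lift ∘ T)
    N' = (λ _ → 0) ◂ N

    steps' : ∀ i → i < suc n → OStep Σ' (F' i) (T' i) (N' i) (F' (suc i))
    steps' zero    _         = OStep-init F₀≈
    steps' (suc i) (s≤s i<n) = OStep-lift {t = T i} (steps i i<n)

    distinct' : ∀ i j → i < suc n → j < suc n → i ≢ j → ¬ TrigEq (T' i) (T' j)
    distinct' zero    zero    _         _         0≢0 = ⊥-elim (0≢0 refl)
    distinct' zero    (suc j) _         _         _   = init≉lift {T j} {initTrigger} refl
    distinct' (suc i) zero    _         _         _   = lift≉init {T i} {initTrigger} refl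
    distinct' (suc i) (suc j) (s≤s i<n) (s≤s j<n) i≢j =
      distinct i j i<n j<n (i≢j ∘ cong suc) ∘ TrigEq-lift⁻

    fair' : ∀ t → TrigOf Σ' t → ∀ i → i ≤ suc n → Loaded t (F' i) → ∃[ j ] (j < suc n × TrigEq t (T' j))
    fair' t o i i≤ l with origin {t} o
    ... | inj₁ init = 0 , s≤s z≤n , TrigEq-init {t} {initTrigger} init refl
    fair' _ _ zero    _          l | inj₂ (_ , refl , _) = ⊥-elim (Start∉D' (l (here refl)))
    fair' _ _ (suc i) (s≤s i≤n) l | inj₂ (t₀ , refl , o₀) =
      let j , j<n , t₀≈Tj = fair t₀ o₀ i i≤n (Loaded-lift⁻ {t = t₀} ≈F-refl l)
      in suc j , s≤s j<n , TrigEq-lift⁺ t₀≈Tj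

  obl-finite⁻ : FiniteObl (Σ' , D') → FiniteObl (Σr , D)
  obl-finite⁻ (zero , F' , T' , N' , F'₀≈ , steps , distinct , fair)
    with fair initTrigger (here refl) 0 z≤n (λ ())
  ... | _ , () , _
  obl-finite⁻ (suc n , F' , T' , N' , F'₀≈ , steps , distinct , fair) =
    n , F , T , N , ⇑⁻¹-embed F'₁≈ , steps' , distinct' , fair'
    where
    F = λ k → ⇑⁻¹ (F' (suc k))
    T = λ k → unlift (T' (suc k))
    N = λ k → N' (suc k)

    T'₀-init : trule (T' 0) ≡ initRule
    T'₀-init = proj₁ (OStep-init⁻ F'₀≈ (steps 0 (s≤s z≤n)))

    F'₁≈ : F' 1 ≈F embed (facts D)
    F'₁≈ = proj₂ (OStep-init⁻ F'₀≈ (steps 0 (s≤s z≤n)))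

    T'-lifted : ∀ k → k < n → T' (suc k) ≡ lift (T k)
    T'-lifted k k<n = lifted (proj₁ (steps (suc k) (s≤s k<n))) λ init →
      distinct 0 (suc k) (s≤s z≤n) (s≤s k<n) (λ ()) (TrigEq-init {T' 0} {T' (suc k)} T'₀-init init)

    step : ∀ k → k < n → OStep Σ' (F' (suc k)) (lift (T k)) (N k) (F' (suc (suc k)))
    step k k<n = subst (λ t → OStep Σ' _ t _ _) (T'-lifted k k<n) (steps (suc k) (s≤s k<n))

    simulates : ∀ k → k ≤ n → Simulates (F' (suc k)) (F k)
    simulates zero    _   = Simulates-init F'₁≈
    simulates (suc k) k<n = proj₂ (OStep-unlift {t = T k} (simulates k (<⇒≤ k<n)) (step k k<n))

    steps' : ∀ i → i < n → OStep Σr (F i) (T i) (N i) (F (suc i))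
    steps' k k<n = proj₁ (OStep-unlift {t = T k} (simulates k (<⇒≤ k<n)) (step k k<n))

    distinct' : ∀ i j → i < n → j < n → i ≢ j → ¬ TrigEq (T i) (T j)
    distinct' i j i<n j<n i≢j Ti≈Tj =
      distinct (suc i) (suc j) (s≤s i<n) (s≤s j<n) (i≢j ∘ suc-injective)
               (subst₂ TrigEq (≡.sym (T'-lifted i i<n)) (≡.sym (T'-lifted j j<n)) (TrigEq-lift⁺ Ti≈Tj))

    fair' : ∀ t → TrigOf Σr t → ∀ i → i ≤ n → Loaded t (F i) → ∃[ j ] (j < n × TrigEq t (T j))
    fair' t o i i≤n l
      with fair (lift t) (TrigOf-lift {t} o) (suc i) (s≤s i≤n) (Loaded-lift⁺ {t = t} (proj₁ (simulates i i≤n)) l)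
    ... | zero  , _         , t≈T'₀ = ⊥-elim (lift≉init {t} {T' 0} T'₀-init t≈T'₀)
    ... | suc j , s≤s j<n , t≈T'ⱼ = j , j<n , TrigEq-lift⁻ (subst (TrigEq (lift t)) (T'-lifted j j<n) t≈T'ⱼ)

  obl-infinite⁺ : InfiniteObl (Σr , D) → InfiniteObl (Σ' , D')
  obl-infinite⁺ (F , T , N , F₀≈ , steps , distinct , fair) =
    F' , T' , N' , ≈F-refl , steps' , distinct' , fair'
    where
    F' = facts D' ◂ (embed ∘ F)
    T' = initTrigger ◂ (lift ∘ T)
    N' = (λ _ → 0) ◂ N

    steps' : ∀ i → OStep Σ' (F' i) (T' i) (N' i) (F' (suc i))
    steps' zero    = OStep-init F₀≈
    steps' (suc i) = OStep-lift {t = T i} (steps i)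

    distinct' : ∀ i j → i ≢ j → ¬ TrigEq (T' i) (T' j)
    distinct' zero    zero    0≢0 = ⊥-elim (0≢0 refl)
    distinct' zero    (suc j) _   = init≉lift {T j} {initTrigger} refl
    distinct' (suc i) zero    _   = lift≉init {T i} {initTrigger} refl
    distinct' (suc i) (suc j) i≢j = distinct i j (i≢j ∘ cong suc) ∘ TrigEq-lift⁻

    fair' : ∀ t → TrigOf Σ' t → ∀ i → Loaded t (F' i) → ∃[ j ] TrigEq t (T' j)
    fair' t o i l with origin {t} o
    ... | inj₁ init = 0 , TrigEq-init {t} {initTrigger} init refl
    fair' _ _ zero    l | inj₂ (_ , refl , _) = ⊥-elim (Start∉D' (l (here refl)))
    fair' _ _ (suc i) l | inj₂ (t₀ , refl , o₀) =
      let j , t₀≈Tj = fair t₀ o₀ i (Loaded-lift⁻ {t = t₀} ≈F-refl l) in suc j , TrigEq-lift⁺ t₀≈Tj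

  obl-infinite⁻ : InfiniteObl (Σ' , D') → InfiniteObl (Σr , D)
  obl-infinite⁻ (F' , T' , N' , F'₀≈ , steps , distinct , fair) =
    F , T , N , ⇑⁻¹-embed F'₁≈ , steps' , distinct' , fair'
    where
    F = λ k → ⇑⁻¹ (F' (suc k))
    T = λ k → unlift (T' (suc k))
    N = λ k → N' (suc k)

    T'₀-init : trule (T' 0) ≡ initRule
    T'₀-init = proj₁ (OStep-init⁻ F'₀≈ (steps 0))

    F'₁≈ : F' 1 ≈F embed (facts D)
    F'₁≈ = proj₂ (OStep-init⁻ F'₀≈ (steps 0))

    T'-lifted : ∀ k → T' (suc k) ≡ lift (T k)
    T'-lifted k = lifted (proj₁ (steps (suc k))) λ init →
      distinct 0 (suc k) (λ ()) (TrigEq-init {T' 0} {T' (suc k)} T'₀-init init)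

    step : ∀ k → OStep Σ' (F' (suc k)) (lift (T k)) (N k) (F' (suc (suc k)))
    step k = subst (λ t → OStep Σ' _ t _ _) (T'-lifted k) (steps (suc k))

    simulates : ∀ k → Simulates (F' (suc k)) (F k)
    simulates zero    = Simulates-init F'₁≈
    simulates (suc k) = proj₂ (OStep-unlift {t = T k} (simulates k) (step k))

    steps' : ∀ i → OStep Σr (F i) (T i) (N i) (F (suc i))
    steps' k = proj₁ (OStep-unlift {t = T k} (simulates k) (step k))

    distinct' : ∀ i j → i ≢ j → ¬ TrigEq (T i) (T j)
    distinct' i j i≢j Ti≈Tj =
      distinct (suc i) (suc j) (i≢j ∘ suc-injective)
               (subst₂ TrigEq (≡.sym (T'-lifted i)) (≡.sym (T'-lifted j)) (TrigEq-lift⁺ Ti≈Tj))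

    fair' : ∀ t → TrigOf Σr t → ∀ i → Loaded t (F i) → ∃[ j ] TrigEq t (T j)
    fair' t o i l with fair (lift t) (TrigOf-lift {t} o) (suc i) (Loaded-lift⁺ {t = t} (proj₁ (simulates i)) l)
    ... | zero  , t≈T'₀ = ⊥-elim (lift≉init {t} {T' 0} T'₀-init t≈T'₀)
    ... | suc j , t≈T'ⱼ = j , TrigEq-lift⁻ (subst (TrigEq (lift t)) (T'-lifted j) t≈T'ⱼ)

  -- Core chase

  ParStep-lift : ∀ {F G} → facts D ⊆ F → ParStep Σr F G → ParStep Σ' (embed F) (embed G)
  ParStep-lift {F} {G} D⊆F par@(N , N-resp , N-fresh , N-distinct , memb) =
    N' , N'-resp , N'-fresh , N'-distinct , λ a → to a , from a
    where
    s : Simulates (embed F) F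
    s = ≈F-refl , D⊆F
    N' : Trigger → ℕ → ℕ
    N' t = N (unlift t)

    N'-resp : ∀ t t' → TrigEq t t' → ∀ v → N' t v ≡ N' t' v
    N'-resp t t' t≈t' = N-resp (unlift t) (unlift t') (TrigEq-unlift t≈t')

    N'-fresh : ∀ t → Active Σ' (embed F) t → Fresh (embed F) t (N' t)
    N'-fresh t active with active-lifted s active
    ... | t₀ , refl , active₀ rewrite unlift-lift t₀ = Fresh-lift⁺ {t = t₀} ≈F-refl (N-fresh t₀ active₀)

    N'-distinct : ∀ t t' → Active Σ' (embed F) t → Active Σ' (embed F) t' → ¬ TrigEq t t' →
                  ∀ u w → EVar (trule t) u → EVar (trule t') w → N' t u ≢ N' t' w
    N'-distinct t t' active active' t≉t' u w eu ew with active-lifted s active | active-lifted s active'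
    ... | t₀ , refl , active₀ | t₁ , refl , active₁ rewrite unlift-lift t₀ | unlift-lift t₁ =
      N-distinct t₀ t₁ active₀ active₁ (t≉t' ∘ TrigEq-lift⁺) u w
                 (EVar-lift⁻ (trule t₀) eu) (EVar-lift⁻ (trule t₁) ew)

    to : ∀ a → a ∈ embed G → InPar Σ' (embed F) N' a
    to a a∈ with ∈-embed⁻ G a∈
    ... | inj₁ a∈Base = inj₁ (Base⊆embed F a∈Base)
    ... | inj₂ (b , b∈ , refl) with proj₁ (memb b) b∈
    ...   | inj₁ b∈F                  = inj₁ (⇑∈embed⁺ b∈F)
    ...   | inj₂ (t , active , b∈out) =
      inj₂ (lift t , Active-lift⁺ {t = t} ≈F-refl active ,
            subst (⇑ b ∈_) (≡.sym (output-lift t _))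
                  (∈-map⁺ ⇑ (subst (λ t₀ → b ∈ output t (N t₀)) (≡.sym (unlift-lift t)) b∈out)))

    from : ∀ a → InPar Σ' (embed F) N' a → a ∈ embed G
    from a (inj₁ a∈) = embed-⊆ (ParStep-⊆ {Σr} par) a∈
    from a (inj₂ (t , active , a∈out)) with active-lifted s active
    ... | t₀ , refl , active₀ with ∈-map⁻ ⇑ (subst (a ∈_) (output-lift t₀ (N' (lift t₀))) a∈out)
    ...   | b , b∈out , refl =
      ⇑∈embed⁺ (proj₂ (memb b)
        (inj₂ (t₀ , active₀ , subst (λ t₁ → b ∈ output t₀ (N t₁)) (unlift-lift t₀) b∈out)))

  ParStep-unlift : ∀ {F' F G'} → Simulates F' F → ParStep Σ' F' G' →
                   G' ≈F embed (⇑⁻¹ G') × ParStep Σr F (⇑⁻¹ G')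
  ParStep-unlift {F'} {F} {G'} s@(F'≈ , _) par'@(N' , N'-resp , N'-fresh , N'-distinct , memb') =
    G'≈ , N , N-resp , N-fresh , N-distinct , λ a → to a , from a
    where
    N : Trigger → ℕ → ℕ
    N t = N' (lift t)

    N-resp : ∀ t t' → TrigEq t t' → ∀ v → N t v ≡ N t' v
    N-resp t t' t≈t' = N'-resp (lift t) (lift t') (TrigEq-lift⁺ t≈t')

    N-fresh : ∀ t → Active Σr F t → Fresh F t (N t)
    N-fresh t active = Fresh-lift⁻ {t = t} F'≈ (N'-fresh (lift t) (Active-lift⁺ {t = t} F'≈ active))

    N-distinct : ∀ t t' → Active Σr F t → Active Σr F t' → ¬ TrigEq t t' →
                 ∀ u w → EVar (trule t) u → EVar (trule t') w → N t u ≢ N t' w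
    N-distinct t t' active active' t≉t' u w eu ew =
      N'-distinct (lift t) (lift t') (Active-lift⁺ {t = t} F'≈ active) (Active-lift⁺ {t = t'} F'≈ active')
                  (t≉t' ∘ TrigEq-lift⁻) u w (EVar-lift⁺ (trule t) eu) (EVar-lift⁺ (trule t') ew)

    shape : ∀ {a} → a ∈ G' → a ∈ Base ⊎ ∃[ b ] a ≡ ⇑ b
    shape a∈ with proj₁ (memb' _) a∈
    ... | inj₁ a∈F' with ∈-embed⁻ F (proj₁ F'≈ a∈F')
    ...   | inj₁ a∈Base        = inj₁ a∈Base
    ...   | inj₂ (b , _ , a≡⇑b) = inj₂ (b , a≡⇑b)
    shape a∈ | inj₂ (t , active , a∈out) with active-lifted s active
    ... | t₀ , refl , _ with ∈-map⁻ ⇑ (subst (_ ∈_) (output-lift t₀ _) a∈out)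
    ...   | b , _ , a≡⇑b = inj₂ (b , a≡⇑b)

    G'≈ : G' ≈F embed (⇑⁻¹ G')
    G'≈ = Base⊆⇒embed-⇑⁻¹ (ParStep-⊆ {Σ'} par' ∘ proj₂ F'≈ ∘ Base⊆embed F) shape

    to : ∀ a → a ∈ ⇑⁻¹ G' → InPar Σr F N a
    to a a∈ with proj₁ (memb' (⇑ a)) (∈-⇑⁻¹⁻ G' a∈)
    ... | inj₁ ⇑a∈F' = inj₁ (⇑∈embed⁻ F (proj₁ F'≈ ⇑a∈F'))
    ... | inj₂ (t , active , ⇑a∈out) with active-lifted s active
    ...   | t₀ , refl , active₀ = inj₂ (t₀ , active₀ , ∈-map-⇑⁻ (subst (⇑ a ∈_) (output-lift t₀ _) ⇑a∈out))

    from : ∀ a → InPar Σr F N a → a ∈ ⇑⁻¹ G'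
    from a (inj₁ a∈F) = ∈-⇑⁻¹⁺ G' (ParStep-⊆ {Σ'} par' (proj₂ F'≈ (⇑∈embed⁺ a∈F)))
    from a (inj₂ (t , active , a∈out)) =
      ∈-⇑⁻¹⁺ G' (proj₂ (memb' (⇑ a))
        (inj₂ (lift t , Active-lift⁺ {t = t} F'≈ active ,
               subst (⇑ a ∈_) (≡.sym (output-lift t _)) (∈-map⁺ ⇑ a∈out))))

  InPar-init⁺ : ∀ {F₀ N a} → F₀ ≈F facts D' → a ∈ embed (facts D) → InPar Σ' F₀ N a
  InPar-init⁺ {N = N} {a} F₀≈ a∈ with ∈-++⁻ (facts D') a∈
  ... | inj₁ a∈D'  = inj₁ (proj₂ F₀≈ a∈D')
  ... | inj₂ a∈out =
    inj₂ (initTrigger , initTrigger-active F₀≈ ,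
          subst (a ∈_) (≡.sym (output-init {initTrigger} {N initTrigger} refl)) a∈out)

  InPar-init⁻ : ∀ {F₀ N a} → F₀ ≈F facts D' → InPar Σ' F₀ N a → a ∈ embed (facts D)
  InPar-init⁻ F₀≈ (inj₁ a∈F₀)                  = ∈-++⁺ˡ (proj₁ F₀≈ a∈F₀)
  InPar-init⁻ F₀≈ (inj₂ (t , (o , l , _) , a∈out)) =
    ∈-++⁺ʳ (facts D') (subst (_ ∈_) (output-init {t} (loaded-on-D'⇒init F₀≈ o l)) a∈out)

  CoreStep-init : ∀ {F₀} → F₀ ≈F facts D → CoreStep Σ' (facts D') (embed F₀)
  CoreStep-init F₀≈ =
    embed (facts D) , par ,
    CoreOf-resp-≈F ≈F-refl (embed-≈F (≈F-sym F₀≈)) (const⇒CoreOf-self (embed-const (proj₂ D)))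
    where
    init : ∀ {t} → Active Σ' (facts D') t → trule t ≡ initRule
    init (o , l , _) = loaded-on-D'⇒init ≈F-refl o l
    par : ParStep Σ' (facts D') (embed (facts D))
    par = (λ _ _ → 0) , (λ _ _ _ _ → refl) , (λ t → init-fresh {facts D'} {t} ∘ init) ,
          (λ t t' active active' t≉t' → ⊥-elim (t≉t' (TrigEq-init {t} {t'} (init active) (init active')))) ,
          λ a → InPar-init⁺ ≈F-refl , InPar-init⁻ ≈F-refl

  CoreStep-init⁻ : ∀ {F₀ F₁} → F₀ ≈F facts D' → CoreStep Σ' F₀ F₁ → F₁ ≈F embed (facts D)
  CoreStep-init⁻ F₀≈ (G , (_ , _ , _ , _ , memb) , coreOf) =
    const-CoreOf⇒≈F (embed-const (proj₂ D)) (CoreOf-resp-≈F G≈ ≈F-refl coreOf)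
    where
    G≈ : G ≈F embed (facts D)
    G≈ = (λ a∈ → InPar-init⁻ F₀≈ (proj₁ (memb _) a∈)) , (λ a∈ → proj₂ (memb _) (InPar-init⁺ F₀≈ a∈))

  CoreStep-lift : ∀ {F C} → facts D ⊆ F → CoreStep Σr F C → CoreStep Σ' (embed F) (embed C)
  CoreStep-lift D⊆F (G , par , coreOf) = embed G , ParStep-lift D⊆F par , CoreOf-embed⁺ coreOf

  CoreStep-unlift : ∀ {F' F C'} → Simulates F' F → CoreStep Σ' F' C' →
                    CoreStep Σr F (⇑⁻¹ C') × Simulates C' (⇑⁻¹ C')
  CoreStep-unlift {F'} {F} {C'} s (G' , par' , coreOf'@(C'⊆G' , (h , hom) , _)) =
    (⇑⁻¹ G' , par , CoreOf-embed⁻ (CoreOf-resp-≈F G'≈ C'≈ coreOf')) , C'≈ , D⊆C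
    where
    G'≈ = proj₁ (ParStep-unlift s par')
    par = proj₂ (ParStep-unlift s par')

    shape : ∀ {a} → a ∈ C' → a ∈ Base ⊎ ∃[ b ] a ≡ ⇑ b
    shape a∈ with ∈-embed⁻ (⇑⁻¹ G') (proj₁ G'≈ (C'⊆G' a∈))
    ... | inj₁ a∈Base        = inj₁ a∈Base
    ... | inj₂ (b , _ , a≡⇑b) = inj₂ (b , a≡⇑b)

    C'≈ : C' ≈F embed (⇑⁻¹ C')
    C'≈ = Base⊆⇒embed-⇑⁻¹ (λ a∈ → Hom-keeps-const hom (Base-const a∈) (proj₂ G'≈ (Base⊆embed _ a∈))) shape

    D⊆C : facts D ⊆ ⇑⁻¹ C'
    D⊆C {d} d∈ = ∈-⇑⁻¹⁺ C' (Hom-keeps-const hom (All.lookup (proj₂ D) d∈)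
                                 (proj₂ G'≈ (⇑∈embed⁺ (ParStep-⊆ {Σr} par (proj₂ s d∈)))))

  core-finite⁺ : FiniteCore (Σr , D) → FiniteCore (Σ' , D')
  core-finite⁺ (n , F , F₀≈ , steps , final) = suc n , F' , ≈F-refl , steps' , final'
    where
    F' = facts D' ◂ (embed ∘ F)

    D⊆F : ∀ i → i ≤ n → facts D ⊆ F i
    D⊆F zero    _   = proj₂ F₀≈
    D⊆F (suc i) i<n = CoreStep-keeps-const {Σr} (proj₂ D) (D⊆F i (<⇒≤ i<n)) (proj₂ (steps i i<n))

    steps' : ∀ i → i < suc n → (∃[ t ] Active Σ' (F' i) t) × CoreStep Σ' (F' i) (F' (suc i))
    steps' zero    _         = (initTrigger , initTrigger-active ≈F-refl) , CoreStep-init F₀≈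
    steps' (suc i) (s≤s i<n) =
      let (t , active) , step = steps i i<n
      in (lift t , Active-lift⁺ {t = t} ≈F-refl active) , CoreStep-lift (D⊆F i (<⇒≤ i<n)) step

    final' : ∀ t → ¬ Active Σ' (F' (suc n)) t
    final' t active =
      let t₀ , _ , active₀ = active-lifted (≈F-refl , D⊆F n ≤-refl) active in final t₀ active₀

  core-finite⁻ : FiniteCore (Σ' , D') → FiniteCore (Σr , D)
  core-finite⁻ (zero , F' , F'₀≈ , steps , final) = ⊥-elim (final initTrigger (initTrigger-active F'₀≈))
  core-finite⁻ (suc n , F' , F'₀≈ , steps , final) = n , F , ⇑⁻¹-embed F'₁≈ , steps' , final'
    where
    F = λ k → ⇑⁻¹ (F' (suc k))

    F'₁≈ : F' 1 ≈F embed (facts D)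
    F'₁≈ = CoreStep-init⁻ F'₀≈ (proj₂ (steps 0 (s≤s z≤n)))

    simulates : ∀ k → k ≤ n → Simulates (F' (suc k)) (F k)
    simulates zero    _   = Simulates-init F'₁≈
    simulates (suc k) k<n =
      proj₂ (CoreStep-unlift (simulates k (<⇒≤ k<n)) (proj₂ (steps (suc k) (s≤s k<n))))

    steps' : ∀ i → i < n → (∃[ t ] Active Σr (F i) t) × CoreStep Σr (F i) (F (suc i))
    steps' k k<n =
      let (t , active) , step = steps (suc k) (s≤s k<n)
          s                   = simulates k (<⇒≤ k<n)
          t₀ , _ , active₀    = active-lifted s active
      in (t₀ , active₀) , proj₁ (CoreStep-unlift s step)

    final' : ∀ t → ¬ Active Σr (F n) t
    final' t active = final (lift t) (Active-lift⁺ {t = t} (proj₁ (simulates n ≤-refl)) active)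

  core-infinite⁺ : InfiniteCore (Σr , D) → InfiniteCore (Σ' , D')
  core-infinite⁺ (F , F₀≈ , steps) = F' , ≈F-refl , steps'
    where
    F' = facts D' ◂ (embed ∘ F)

    D⊆F : ∀ i → facts D ⊆ F i
    D⊆F zero    = proj₂ F₀≈
    D⊆F (suc i) = CoreStep-keeps-const {Σr} (proj₂ D) (D⊆F i) (proj₂ (steps i))

    steps' : ∀ i → (∃[ t ] Active Σ' (F' i) t) × CoreStep Σ' (F' i) (F' (suc i))
    steps' zero    = (initTrigger , initTrigger-active ≈F-refl) , CoreStep-init F₀≈
    steps' (suc i) =
      let (t , active) , step = steps i
      in (lift t , Active-lift⁺ {t = t} ≈F-refl active) , CoreStep-lift (D⊆F i) step

  core-infinite⁻ : InfiniteCore (Σ' , D') → InfiniteCore (Σr , D)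
  core-infinite⁻ (F' , F'₀≈ , steps) = F , ⇑⁻¹-embed F'₁≈ , steps'
    where
    F = λ k → ⇑⁻¹ (F' (suc k))

    F'₁≈ : F' 1 ≈F embed (facts D)
    F'₁≈ = CoreStep-init⁻ F'₀≈ (proj₂ (steps 0))

    simulates : ∀ k → Simulates (F' (suc k)) (F k)
    simulates zero    = Simulates-init F'₁≈
    simulates (suc k) = proj₂ (CoreStep-unlift (simulates k) (proj₂ (steps (suc k))))

    steps' : ∀ i → (∃[ t ] Active Σr (F i) t) × CoreStep Σr (F i) (F (suc i))
    steps' k =
      let (t , active) , step = steps (suc k)
          t₀ , _ , active₀    = active-lifted (simulates k) active
      in (t₀ , active₀) , proj₁ (CoreStep-unlift (simulates k) step)

  finite⇔ : ∀ v → FiniteSeq v (Σr , D) ⇔ FiniteSeq v (Σ' , D')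
  finite⇔ obl  = mk⇔ obl-finite⁺ obl-finite⁻
  finite⇔ rest = mk⇔ rest-finite⁺ rest-finite⁻
  finite⇔ core = mk⇔ core-finite⁺ core-finite⁻

  infinite⇔ : ∀ v → InfiniteSeq v (Σr , D) ⇔ InfiniteSeq v (Σ' , D')
  infinite⇔ obl  = mk⇔ obl-infinite⁺ obl-infinite⁻
  infinite⇔ rest = mk⇔ rest-infinite⁺ rest-infinite⁻
  infinite⇔ core = mk⇔ core-infinite⁺ core-infinite⁻

  CT⇔ : ∀ v Q → CT v Q (Σr , D) ⇔ CT v Q (Σ' , D')
  CT⇔ v ∃Q = finite⇔ v
  CT⇔ v ∀Q = ¬-cong-⇔ (infinite⇔ v)

proposition3p1 : (D' : Database) (Q : Quant) (v : Variant) →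
    ManyOne (CT v Q) (CTD D' v Q) × ManyOne (CTD D' v Q) (CT v Q)
proposition3p1 D' Q v =
  ((λ (Σr , D) → Reduction.Σ' D' Σr D) , λ (Σr , D) → Reduction.CT⇔ D' Σr D v Q) ,
  ((λ Σr → Σr , D') , λ Σr → ⇔-id (CTD D' v Q Σr))
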